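{- Let $T:\mathbb N\to\mathbb N$ be defined by $T(n)=n/2$ if $n$ is even and $T(n)=(3n+1)/2$ if $n$ is odd, and let $T^{(k)}$ denote its $k$-th iterate. The following two statements are equivalent: (A) for every integer $n_0 \ge 1$ there exists $k \ge 1$ with $T^{(k)}(n_0)=1$; (B) for every integer $n_0 \ge 1$, the proportion of even numbers among $n_0, T(n_0), T^{(2)}(n_0), \dots, T^{(k-1)}(n_0)$ tends to $1/2$ as $k \to \infty$.
   Context: $\mathbb N = \{0,1,2,\dots\}$. -}

module Defs where

open import Data.Nat using (ℕ; zero; suc; _+_; _*_)
open import Data.Nat.DivMod using (_/_)
open import Data.Nat.Divisibility using (_∣_; _∣?_)
open import Relation.Nullary using (yes; no)

T : ℕ → ℕ
T n with 2 ∣? n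
... | yes _ = n / 2
... | no  _ = (3 * n + 1) / 2

T^ : ℕ → ℕ → ℕ
T^ zero    n = n
T^ (suc k) n = T (T^ k n)

evenCount : ℕ → ℕ → ℕ
evenCount n zero = 0
evenCount n (suc k) with 2 ∣? T^ k n
... | yes _ = suc (evenCount n k)
... | no  _ = evenCount n k

{-# OPTIONS --safe #-}
module Submission where

-- Once the orbit of n reaches 1 it cycles 1 ↦ 2 ↦ 1, so the number E of even terms among its first
-- N terms stays within a bounded distance of N/2, and E/N → 1/2.
--
-- Conversely, take the tolerance 1/18: then beyond some K at most 5N/9 of the first N terms are odd.
-- While the orbit avoids 1 every odd term x is at least 3, so an odd step multiplies by
-- (3x+1)/(2x) ≤ 5/3 and an even step by 1/2; with O odd steps, 3^O 2^N T^N(n) ≤ n 10^O. Together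
-- with 9O ≤ 5N this gives (3⁵ 2⁹ / 10⁵)^N ≤ n⁹, and since (3⁵ 2⁹ / 10⁵)⁴ > 2 also 2^N ≤ n³⁶,
-- impossible once N > n³⁶. Hence the orbit meets 1 among its first N terms for N > max(K, n³⁶),
-- where a bounded search finds it.

open import Defs

-- A module of its own because ℕ's ∣_-_∣, _<_ and _/_ clash with the rational operators of the statement.
module Arithmetic where

  open import Algebra.Properties.CommutativeSemigroup as CommSemigroup using ()
  import Data.Integer as ℤ
  import Data.Integer.Properties as ℤP
  open import Data.Nat
  open import Data.Nat.Divisibility using (_∣_; _∣?_; ∣⇒≤; ∣-refl)
  open import Data.Nat.DivMod using (m/n*n≤m; m≥n⇒m/n>0)
  open import Data.Nat.Properties
  open import Data.Nat.Tactic.RingSolver using (solve-∀)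
  open import Data.Sum using (inj₁; inj₂)
  open import Relation.Nullary using (¬_; yes; no; contradiction)
  open import Relation.Binary.PropositionalEquality

  open CommSemigroup *-commutativeSemigroup using (interchange; xy∙z≈xz∙y; x∙yz≈y∙xz)

  T^-+ : ∀ k m n → T^ (k + m) n ≡ T^ k (T^ m n)
  T^-+ zero    m n = refl
  T^-+ (suc k) m n = cong T (T^-+ k m n)

  T-positive : ∀ {x} → x ≥ 1 → T x ≥ 1
  T-positive {x} x≥1 with 2 ∣? x
  ... | yes 2∣x = m≥n⇒m/n>0 (∣⇒≤ {{>-nonZero x≥1}} 2∣x)
  ... | no  _   = m≥n⇒m/n>0 (+-monoˡ-≤ 1 (≤-trans x≥1 (m≤n*m x 3)))

  T^-positive : ∀ {n} → n ≥ 1 → ∀ N → T^ N n ≥ 1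
  T^-positive n≥1 zero    = n≥1
  T^-positive n≥1 (suc N) = T-positive (T^-positive n≥1 N)

  odd-≢1⇒≥3 : ∀ {x} → x ≥ 1 → x ≢ 1 → ¬ 2 ∣ x → x ≥ 3
  odd-≢1⇒≥3 {1}                 _ x≢1 _   = contradiction refl x≢1
  odd-≢1⇒≥3 {2}                 _ _   2∤x = contradiction ∣-refl 2∤x
  odd-≢1⇒≥3 {suc (suc (suc _))} _ _   _   = s≤s (s≤s (s≤s z≤n))

  3[3x+1]≤10x : ∀ {x} → x ≥ 3 → 3 * (3 * x + 1) ≤ 10 * x
  3[3x+1]≤10x {x} x≥3 = begin
    3 * (3 * x + 1) ≡⟨ *-distribˡ-+ 3 (3 * x) 1 ⟩
    3 * (3 * x) + 3 ≡⟨ cong (_+ 3) (*-assoc 3 3 x) ⟨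
    9 * x + 3       ≤⟨ +-monoʳ-≤ (9 * x) x≥3 ⟩
    9 * x + x       ≡⟨ +-comm (9 * x) x ⟩
    10 * x          ∎
    where open ≤-Reasoning

  oddCount : ℕ → ℕ → ℕ
  oddCount n zero = 0
  oddCount n (suc k) with 2 ∣? T^ k n
  ... | yes _ = oddCount n k
  ... | no  _ = suc (oddCount n k)

  evenCount+oddCount : ∀ n k → evenCount n k + oddCount n k ≡ k
  evenCount+oddCount n zero = refl
  evenCount+oddCount n (suc k) with 2 ∣? T^ k n
  ... | yes _ = cong suc (evenCount+oddCount n k)
  ... | no  _ = trans (+-suc _ _) (cong suc (evenCount+oddCount n k))

  evenCount-+ : ∀ n k m → evenCount n (k + m) ≡ evenCount (T^ m n) k + evenCount n m
  evenCount-+ n zero    m = refl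
  evenCount-+ n (suc k) m with 2 ∣? T^ (k + m) n | 2 ∣? T^ k (T^ m n)
  ... | yes _   | yes _   = cong suc (evenCount-+ n k m)
  ... | no  _   | no  _   = evenCount-+ n k m
  ... | yes 2∣x | no  2∤x = contradiction (subst (2 ∣_) (T^-+ k m n) 2∣x) 2∤x
  ... | no  2∤x | yes 2∣x = contradiction (subst (2 ∣_) (sym (T^-+ k m n)) 2∣x) 2∤x

  ∣m+n-o+p∣≤∣m-o∣+∣n-p∣ : ∀ m n o p → ∣ m + n - (o + p) ∣ ≤ ∣ m - o ∣ + ∣ n - p ∣
  ∣m+n-o+p∣≤∣m-o∣+∣n-p∣ m n o p = begin
    ∣ m + n - o + p ∣                     ≤⟨ ∣-∣-triangle (m + n) (o + n) (o + p) ⟩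
    ∣ m + n - o + n ∣ + ∣ o + n - o + p ∣ ≡⟨ cong₂ _+_ first (∣m+n-m+o∣≡∣n-o∣ o n p) ⟩
    ∣ m - o ∣ + ∣ n - p ∣                 ∎
    where
    open ≤-Reasoning
    first : ∣ m + n - o + n ∣ ≡ ∣ m - o ∣
    first = trans (cong₂ ∣_-_∣ (+-comm m n) (+-comm o n)) (∣m+n-m+o∣≡∣n-o∣ n m o)

  imbalance : ℕ → ℕ → ℕ
  imbalance E N = ∣ E * 2 - N ∣

  ∣m⊖n∣≡∣m-n∣ : ∀ m n → ℤ.∣ m ℤ.⊖ n ∣ ≡ ∣ m - n ∣
  ∣m⊖n∣≡∣m-n∣ m n with ≤-total m n
  ... | inj₁ m≤n = trans (ℤP.∣⊖∣-≤ m≤n) (sym (m≤n⇒∣m-n∣≡n∸m m≤n))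
  ... | inj₂ n≤m = trans (ℤP.∣m⊖n∣≡∣n⊖m∣ m n)
                     (trans (ℤP.∣⊖∣-≤ n≤m) (sym (m≤n⇒∣n-m∣≡n∸m n≤m)))

  discrepancy : ℕ → ℕ → ℕ
  discrepancy n k = imbalance (evenCount n k) k

  discrepancy-+ : ∀ n k m → discrepancy n (k + m) ≤ discrepancy (T^ m n) k + discrepancy n m
  discrepancy-+ n k m = begin
    ∣ evenCount n (k + m) * 2 - k + m ∣ ≡⟨ cong (λ e → ∣ e * 2 - k + m ∣) (evenCount-+ n k m) ⟩
    ∣ (E₁ + E₂) * 2 - k + m ∣           ≡⟨ cong (λ e → ∣ e - k + m ∣) (*-distribʳ-+ 2 E₁ E₂) ⟩
    ∣ E₁ * 2 + E₂ * 2 - k + m ∣         ≤⟨ ∣m+n-o+p∣≤∣m-o∣+∣n-p∣ (E₁ * 2) (E₂ * 2) k m ⟩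
    discrepancy (T^ m n) k + discrepancy n m ∎
    where
    open ≤-Reasoning
    E₁ = evenCount (T^ m n) k
    E₂ = evenCount n m

  discrepancy-one : ∀ k → discrepancy 1 k ≤ 1
  discrepancy-one zero          = z≤n
  discrepancy-one (suc zero)    = ≤-refl
  discrepancy-one (suc (suc k)) = begin
    discrepancy 1 (2 + k)     ≡⟨ cong (discrepancy 1) (+-comm 2 k) ⟩
    discrepancy 1 (k + 2)     ≤⟨ discrepancy-+ 1 k 2 ⟩
    -- T^ 2 1 reduces to 1 and discrepancy 1 2 to 0
    discrepancy 1 k + 0       ≡⟨ +-identityʳ _ ⟩
    discrepancy 1 k           ≤⟨ discrepancy-one k ⟩
    1                         ∎
    where open ≤-Reasoning

  reaches-one⇒discrepancy-bounded : ∀ {n m} → T^ m n ≡ 1 →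
                                    ∀ N → N ≥ m → discrepancy n N ≤ suc (discrepancy n m)
  reaches-one⇒discrepancy-bounded {n} {m} T^m≡1 N N≥m = begin
    discrepancy n N                  ≡⟨ cong (discrepancy n) (m∸n+n≡m N≥m) ⟨
    discrepancy n (N ∸ m + m)        ≤⟨ discrepancy-+ n (N ∸ m) m ⟩
    discrepancy (T^ m n) (N ∸ m) + d ≡⟨ cong (λ x → discrepancy x (N ∸ m) + d) T^m≡1 ⟩
    discrepancy 1 (N ∸ m) + d        ≤⟨ +-monoˡ-≤ d (discrepancy-one (N ∸ m)) ⟩
    suc d                            ∎
    where
    open ≤-Reasoning
    d = discrepancy n m

  halving-contracts : ∀ a b {c} x → a * b * x ≤ c → a * (2 * b) * (x / 2) ≤ c
  halving-contracts a b {c} x abx≤c = begin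
    a * (2 * b) * (x / 2) ≡⟨ rearrange a b (x / 2) ⟩
    a * b * (x / 2 * 2)   ≤⟨ *-monoʳ-≤ (a * b) (m/n*n≤m x 2) ⟩
    a * b * x             ≤⟨ abx≤c ⟩
    c                     ∎
    where
    open ≤-Reasoning
    rearrange : ∀ a b y → a * (2 * b) * y ≡ a * b * (y * 2)
    rearrange = solve-∀

  odd-step-contracts : ∀ a b {c x} → x ≥ 3 → a * b * x ≤ c →
                       3 * a * (2 * b) * ((3 * x + 1) / 2) ≤ 10 * c
  odd-step-contracts a b {c} {x} x≥3 abx≤c = begin
    3 * a * (2 * b) * ((3 * x + 1) / 2) ≡⟨ rearrange a b ((3 * x + 1) / 2) ⟩
    a * b * (3 * ((3 * x + 1) / 2 * 2)) ≤⟨ *-monoʳ-≤ (a * b) (*-monoʳ-≤ 3 (m/n*n≤m (3 * x + 1) 2)) ⟩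
    a * b * (3 * (3 * x + 1))           ≤⟨ *-monoʳ-≤ (a * b) (3[3x+1]≤10x x≥3) ⟩
    a * b * (10 * x)                    ≡⟨ x∙yz≈y∙xz (a * b) 10 x ⟩
    10 * (a * b * x)                    ≤⟨ *-monoʳ-≤ 10 abx≤c ⟩
    10 * c                              ∎
    where
    open ≤-Reasoning
    rearrange : ∀ a b y → 3 * a * (2 * b) * y ≡ a * b * (3 * (y * 2))
    rearrange = solve-∀

  orbit-contraction : ∀ {n} N → n ≥ 1 → (∀ j → j < N → T^ j n ≢ 1) →
                      3 ^ oddCount n N * 2 ^ N * T^ N n ≤ n * 10 ^ oddCount n N
  orbit-contraction {n} zero    _   _      = ≤-reflexive (trans (+-identityʳ n) (sym (*-identityʳ n)))
  orbit-contraction {n} (suc N) n≥1 avoids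
    with 2 ∣? T^ N n | orbit-contraction N n≥1 (λ j j<N → avoids j (m<n⇒m<1+n j<N))
  ... | yes _   | ih = halving-contracts (3 ^ oddCount n N) (2 ^ N) (T^ N n) ih
  ... | no  2∤x | ih = ≤-trans (odd-step-contracts (3 ^ oddCount n N) (2 ^ N) x≥3 ih)
                               (≤-reflexive (x∙yz≈y∙xz 10 n _))
    where x≥3 = odd-≢1⇒≥3 (T^-positive n≥1 N) (avoids N ≤-refl) 2∤x

  few-odd-steps : ∀ {E O N} → E + O ≡ N → imbalance E N * 9 < N → O * 9 ≤ 5 * N
  few-odd-steps {E} {O} {N} E+O≡N 9d<N =
    *-cancelʳ-≤ (O * 9) (5 * N) 2 (<⇒≤ (+-cancelˡ-< (N * 9) (O * 9 * 2) (5 * N * 2) (begin-strict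
      N * 9 + O * 9 * 2           ≤⟨ +-monoˡ-≤ (O * 9 * 2) (*-monoˡ-≤ 9 (m≤n+∣n-m∣ N (E * 2))) ⟩
      (E * 2 + d) * 9 + O * 9 * 2 ≡⟨ regroup E O d ⟩
      (E + O) * 18 + d * 9        ≡⟨ cong (λ m → m * 18 + d * 9) E+O≡N ⟩
      N * 18 + d * 9              <⟨ +-monoʳ-< (N * 18) 9d<N ⟩
      N * 18 + N                  ≡⟨ split N ⟩
      N * 9 + 5 * N * 2           ∎)))
    where
    open ≤-Reasoning
    d = imbalance E N
    regroup : ∀ E O d → (E * 2 + d) * 9 + O * 9 * 2 ≡ (E + O) * 18 + d * 9
    regroup = solve-∀
    split : ∀ N → N * 18 + N ≡ N * 9 + 5 * N * 2
    split = solve-∀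

  n<2^n : ∀ n → n < 2 ^ n
  n<2^n zero    = s≤s z≤n
  n<2^n (suc n) = begin-strict
    suc n         <⟨ s≤s (n<2^n n) ⟩
    suc (2 ^ n)   ≤⟨ +-monoˡ-≤ (2 ^ n) (m^n>0 2 n) ⟩
    2 ^ n + 2 ^ n ≡⟨ cong (2 ^ n +_) (+-identityʳ (2 ^ n)) ⟨
    2 * 2 ^ n     ∎
    where open ≤-Reasoning

  ^-distribʳ-* : ∀ m n o → (m * n) ^ o ≡ m ^ o * n ^ o
  ^-distribʳ-* m n zero    = refl
  ^-distribʳ-* m n (suc o) = trans (cong (m * n *_) (^-distribʳ-* m n o)) (interchange m n (m ^ o) (n ^ o))

  ^-^-comm : ∀ m a b → (m ^ a) ^ b ≡ (m ^ b) ^ a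
  ^-^-comm m a b = trans (^-*-assoc m a b) (trans (cong (m ^_) (*-comm a b)) (sym (^-*-assoc m b a)))

  xᴼyᴺ≤czᴼ⇒[xˢyʳ]ᴺ≤cʳ[zˢ]ᴺ : ∀ x y z c O N r s → x ≤ z → O * r ≤ s * N →
                               x ^ O * y ^ N ≤ c * z ^ O → (x ^ s * y ^ r) ^ N ≤ c ^ r * (z ^ s) ^ N
  xᴼyᴺ≤czᴼ⇒[xˢyʳ]ᴺ≤cʳ[zˢ]ᴺ x y z c O N r s x≤z Or≤sN bound = begin
    (x ^ s * y ^ r) ^ N               ≡⟨ ^-distribʳ-* (x ^ s) (y ^ r) N ⟩
    (x ^ s) ^ N * (y ^ r) ^ N         ≡⟨ cong₂ _*_ (^-*-assoc x s N) (^-^-comm y r N) ⟩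
    x ^ (s * N) * (y ^ N) ^ r         ≡⟨ cong (λ e → x ^ e * (y ^ N) ^ r) Or+d≡sN ⟨
    x ^ (O * r + d) * (y ^ N) ^ r     ≡⟨ cong (_* (y ^ N) ^ r) (^-distribˡ-+-* x (O * r) d) ⟩
    x ^ (O * r) * x ^ d * (y ^ N) ^ r ≡⟨ xy∙z≈xz∙y (x ^ (O * r)) (x ^ d) ((y ^ N) ^ r) ⟩
    x ^ (O * r) * (y ^ N) ^ r * x ^ d ≡⟨ cong (λ u → u * (y ^ N) ^ r * x ^ d) (^-*-assoc x O r) ⟨
    (x ^ O) ^ r * (y ^ N) ^ r * x ^ d ≡⟨ cong (_* x ^ d) (^-distribʳ-* (x ^ O) (y ^ N) r) ⟨
    (x ^ O * y ^ N) ^ r * x ^ d       ≤⟨ *-mono-≤ (^-monoˡ-≤ r bound) (^-monoˡ-≤ d x≤z) ⟩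
    (c * z ^ O) ^ r * z ^ d           ≡⟨ cong (_* z ^ d) (^-distribʳ-* c (z ^ O) r) ⟩
    c ^ r * (z ^ O) ^ r * z ^ d       ≡⟨ *-assoc (c ^ r) ((z ^ O) ^ r) (z ^ d) ⟩
    c ^ r * ((z ^ O) ^ r * z ^ d)     ≡⟨ cong (λ u → c ^ r * (u * z ^ d)) (^-*-assoc z O r) ⟩
    c ^ r * (z ^ (O * r) * z ^ d)     ≡⟨ cong (c ^ r *_) (^-distribˡ-+-* z (O * r) d) ⟨
    c ^ r * z ^ (O * r + d)           ≡⟨ cong (λ e → c ^ r * z ^ e) Or+d≡sN ⟩
    c ^ r * z ^ (s * N)               ≡⟨ cong (c ^ r *_) (^-*-assoc z s N) ⟨
    c ^ r * (z ^ s) ^ N               ∎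
    where
    open ≤-Reasoning
    d = s * N ∸ O * r
    Or+d≡sN : O * r + d ≡ s * N
    Or+d≡sN = m+[n∸m]≡n Or≤sN

  aᴺ≤cbᴺ⇒2ᴺ≤cʳ : ∀ a b c r N .{{_ : NonZero b}} →
                  2 * b ^ r ≤ a ^ r → a ^ N ≤ c * b ^ N → 2 ^ N ≤ c ^ r
  aᴺ≤cbᴺ⇒2ᴺ≤cʳ a b c r N 2bʳ≤aʳ aᴺ≤cbᴺ =
    *-cancelʳ-≤ (2 ^ N) (c ^ r) ((b ^ r) ^ N) {{m^n≢0 (b ^ r) N {{m^n≢0 b r}}}} (begin
      2 ^ N * (b ^ r) ^ N ≡⟨ ^-distribʳ-* 2 (b ^ r) N ⟨
      (2 * b ^ r) ^ N     ≤⟨ ^-monoˡ-≤ N 2bʳ≤aʳ ⟩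
      (a ^ r) ^ N         ≡⟨ ^-^-comm a r N ⟩
      (a ^ N) ^ r         ≤⟨ ^-monoˡ-≤ r aᴺ≤cbᴺ ⟩
      (c * b ^ N) ^ r     ≡⟨ ^-distribʳ-* c (b ^ N) r ⟩
      c ^ r * (b ^ N) ^ r ≡⟨ cong (c ^ r *_) (^-^-comm b N r) ⟩
      c ^ r * (b ^ r) ^ N ∎)
    where open ≤-Reasoning

  avoids-one∧few-odd-steps⇒2ᴺ≤n³⁶ : ∀ {n} N → n ≥ 1 → (∀ j → j < N → T^ j n ≢ 1) →
                                    oddCount n N * 9 ≤ 5 * N → 2 ^ N ≤ (n ^ 9) ^ 4
  avoids-one∧few-odd-steps⇒2ᴺ≤n³⁶ {n} N n≥1 avoids few =
    -- 2 (10⁵)⁴ ≤ (3⁵ 2⁹)⁴ holds with ratio ≈ 2.4, and is checked by evaluation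
    aᴺ≤cbᴺ⇒2ᴺ≤cʳ (3 ^ 5 * 2 ^ 9) (10 ^ 5) (n ^ 9) 4 N (≤ᵇ⇒≤ _ _ _)
      (xᴼyᴺ≤czᴼ⇒[xˢyʳ]ᴺ≤cʳ[zˢ]ᴺ 3 2 10 n (oddCount n N) N 9 5 (≤ᵇ⇒≤ _ _ _) few
        (≤-trans (m≤m*n _ (T^ N n) {{>-nonZero (T^-positive n≥1 N)}})
                 (orbit-contraction N n≥1 avoids)))

open Arithmetic

open import Data.Integer as ℤ using (+_; -[1+_])
import Data.Integer.Properties as ℤP
open import Data.Nat using (ℕ; zero; suc; _+_; _*_; _^_; _≤_; _≥_; _>_; z≤n; s≤s; _≟_; anyUpTo?)
open import Data.Nat.Coprimality using (Coprime)
open import Data.Nat.Properties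
open import Data.Empty using (⊥-elim)
open import Data.Product using (_×_; _,_; ∃-syntax)
open import Data.Rational using (ℚ; _/_; _-_; ∣_∣; ½; _<_; 0ℚ; mkℚ; toℚᵘ)
import Data.Rational as ℚ
open import Data.Rational.Properties
  using (toℚᵘ-homo-∣-∣; toℚᵘ-homo-+; toℚᵘ-fromℚᵘ; toℚᵘ-mono-<; toℚᵘ-cancel-<)
import Data.Rational.Unnormalised as ℚᵘ
import Data.Rational.Unnormalised.Properties as ℚᵘP
open import Function.Bundles using (_⇔_; mk⇔; Equivalence)
open import Relation.Nullary using (yes; no)
open import Relation.Binary.PropositionalEquality

-- ℚᵘ.mkℚᵘ a d stands for a / (1 + d): the right-hand side is ∣2E − (k+1)∣ / (2(k+1)).
toℚᵘ-deviation : ∀ E k →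
                 toℚᵘ ∣ (+ E / suc k) - ½ ∣ ℚᵘ.≃ ℚᵘ.mkℚᵘ (+ imbalance E (suc k)) (suc (k * 2))
toℚᵘ-deviation E k = begin
  toℚᵘ ∣ (+ E / suc k) - ½ ∣                       ≈⟨ toℚᵘ-homo-∣-∣ ((+ E / suc k) - ½) ⟩
  ℚᵘ.∣ toℚᵘ ((+ E / suc k) - ½) ∣                  ≈⟨ ℚᵘP.∣-∣-cong (toℚᵘ-homo-+ (+ E / suc k) (ℚ.- ½)) ⟩
  ℚᵘ.∣ toℚᵘ (+ E / suc k) ℚᵘ.+ ℚᵘ.mkℚᵘ -[1+ 0 ] 1 ∣ ≈⟨ ℚᵘP.∣-∣-cong (ℚᵘP.+-congˡ _ (toℚᵘ-fromℚᵘ E/k)) ⟩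
  ℚᵘ.∣ ℚᵘ.mkℚᵘ (+ E) k ℚᵘ.+ ℚᵘ.mkℚᵘ -[1+ 0 ] 1 ∣   ≡⟨ cong (λ a → ℚᵘ.mkℚᵘ (+ a) (suc (k * 2))) numerator ⟩
  ℚᵘ.mkℚᵘ (+ imbalance E (suc k)) (suc (k * 2))   ∎
  where
  open ℚᵘP.≃-Reasoning
  E/k = ℚᵘ.mkℚᵘ (+ E) k
  numerator : ℤ.∣ + E ℤ.* + 2 ℤ.+ -[1+ 0 ] ℤ.* + suc k ∣ ≡ imbalance E (suc k)
  numerator = trans
    (cong ℤ.∣_∣ (trans (cong₂ ℤ._+_ (sym (ℤP.pos-* E 2)) (ℤP.-1*i≡-i (+ suc k))) (ℤP.m-n≡m⊖n (E * 2) (suc k))))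
    (∣m⊖n∣≡∣m-n∣ (E * 2) (suc k))

deviation<⇔ : ∀ E k p q .{c : Coprime p (suc q)} →
              ∣ (+ E / suc k) - ½ ∣ < mkℚ (+ p) q c ⇔ p * (suc k * 2) > imbalance E (suc k) * suc q
deviation<⇔ E k p q = mk⇔ to from
  where
  d = imbalance E (suc k)
  to : ∣ (+ E / suc k) - ½ ∣ < mkℚ (+ p) q _ → p * (suc k * 2) > d * suc q
  to lt with ℚᵘP.<-respˡ-≃ (toℚᵘ-deviation E k) (toℚᵘ-mono-< lt)
  ... | ℚᵘ.*<* lt′ = ℤP.drop‿+<+ (subst₂ ℤ._<_ (sym (ℤP.pos-* d (suc q))) (sym (ℤP.pos-* p _)) lt′)
  from : p * (suc k * 2) > d * suc q → ∣ (+ E / suc k) - ½ ∣ < mkℚ (+ p) q _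
  from gt = toℚᵘ-cancel-< (ℚᵘP.<-respˡ-≃ (ℚᵘP.≃-sym (toℚᵘ-deviation E k))
    (ℚᵘ.*<* (subst₂ ℤ._<_ (ℤP.pos-* d (suc q)) (ℤP.pos-* p _) (ℤ.+<+ gt))))

bounded-imbalance⇒proportion→½ : ∀ (E : ℕ → ℕ) m C → (∀ N → N ≥ m → imbalance (E N) N ≤ C) →
  ∀ ε → 0ℚ < ε → ∃[ K ] ∀ k → k ≥ K → ∣ (+ E (suc k) / suc k) - ½ ∣ < ε
bounded-imbalance⇒proportion→½ E m C bounded (mkℚ (+ zero)  q c) (ℚ.*<* (ℤ.+<+ ()))
bounded-imbalance⇒proportion→½ E m C bounded (mkℚ -[1+ p ]  q c) (ℚ.*<* ())
bounded-imbalance⇒proportion→½ E m C bounded (mkℚ (+ suc p) q c) _ = C * suc q + m , close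
  where
  close : ∀ k → k ≥ C * suc q + m → ∣ (+ E (suc k) / suc k) - ½ ∣ < mkℚ (+ suc p) q c
  close k k≥K = Equivalence.from (deviation<⇔ (E (suc k)) k (suc p) q) (begin-strict
    imbalance (E (suc k)) (suc k) * suc q ≤⟨ *-monoˡ-≤ (suc q) (bounded (suc k) 1+k≥m) ⟩
    C * suc q                             ≤⟨ m+n≤o⇒m≤o (C * suc q) k≥K ⟩
    k                                     <⟨ n<1+n k ⟩
    suc k                                 ≤⟨ m≤m*n (suc k) 2 ⟩
    suc k * 2                             ≤⟨ m≤n*m (suc k * 2) (suc p) ⟩
    suc p * (suc k * 2)                   ∎)
    where
    open ≤-Reasoning
    1+k≥m = m≤n⇒m≤1+n (m+n≤o⇒n≤o (C * suc q) k≥K)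

reaches-one⇒proportion→½ : ∀ {n m} → T^ m n ≡ 1 →
  ∀ ε → 0ℚ < ε → ∃[ K ] ∀ k → k ≥ K → ∣ (+ evenCount n (suc k) / suc k) - ½ ∣ < ε
reaches-one⇒proportion→½ {n} {m} T^m≡1 =
  bounded-imbalance⇒proportion→½ (evenCount n) m (suc (discrepancy n m))
    (reaches-one⇒discrepancy-bounded T^m≡1)

close-to-½⇒few-odd-steps : ∀ n k → ∣ (+ evenCount n (suc k) / suc k) - ½ ∣ < + 1 / 18 →
                           oddCount n (suc k) * 9 ≤ 5 * suc k
close-to-½⇒few-odd-steps n k close =
  few-odd-steps {E = evenCount n (suc k)} (evenCount+oddCount n (suc k))
    (*-cancelʳ-< 2 (d * 9) (suc k) (subst₂ _>_ (*-identityˡ (suc k * 2)) (sym (*-assoc d 9 2))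
      (Equivalence.to (deviation<⇔ (evenCount n (suc k)) k 1 17) close)))
  where d = discrepancy n (suc k)

proportion→½⇒reaches-one : ∀ {n} → n ≥ 1 →
  (∀ ε → 0ℚ < ε → ∃[ K ] ∀ k → k ≥ K → ∣ (+ evenCount n (suc k) / suc k) - ½ ∣ < ε) →
  ∃[ k ] (k ≥ 1 × T^ k n ≡ 1)
proportion→½⇒reaches-one {n} n≥1 proportion→½
  with proportion→½ (+ 1 / 18) (ℚ.*<* (ℤ.+<+ (s≤s z≤n)))
... | K , close with anyUpTo? (λ j → T^ j n ≟ 1) (suc (K + (n ^ 9) ^ 4))
...   | yes (j , _ , T^j≡1) = 2 + j , s≤s z≤n , cong (λ x → T (T x)) T^j≡1 -- 1 ↦ 2 ↦ 1; j itself may be 0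
...   | no  never           = ⊥-elim (<⇒≱ (<-trans (s≤s (m≤n+m _ K)) (n<2^n N))
                                (avoids-one∧few-odd-steps⇒2ᴺ≤n³⁶ N n≥1 avoids few))
  where
  N = suc (K + (n ^ 9) ^ 4)
  avoids : ∀ j → N > j → T^ j n ≢ 1
  avoids j j<N T^j≡1 = never (j , j<N , T^j≡1)
  few = close-to-½⇒few-odd-steps n (K + (n ^ 9) ^ 4) (close _ (m≤m+n K _))

proposition6 :
    ((∀ (n₀ : ℕ) → n₀ ≥ 1 → ∃[ k ] (k ≥ 1 × T^ k n₀ ≡ 1))
      → (∀ (n₀ : ℕ) → n₀ ≥ 1 → ∀ (ε : ℚ) → 0ℚ < ε → ∃[ K ] ∀ (k : ℕ) → k ≥ K
           → ∣ ((+ evenCount n₀ (suc k)) / suc k) - ½ ∣ < ε))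
    × ((∀ (n₀ : ℕ) → n₀ ≥ 1 → ∀ (ε : ℚ) → 0ℚ < ε → ∃[ K ] ∀ (k : ℕ) → k ≥ K
           → ∣ ((+ evenCount n₀ (suc k)) / suc k) - ½ ∣ < ε)
      → (∀ (n₀ : ℕ) → n₀ ≥ 1 → ∃[ k ] (k ≥ 1 × T^ k n₀ ≡ 1)))
proposition6 =
    (λ reachesOne n n≥1 → let m , _ , T^m≡1 = reachesOne n n≥1 in reaches-one⇒proportion→½ {m = m} T^m≡1)
  , (λ proportion→½ n n≥1 → proportion→½⇒reaches-one n≥1 (proportion→½ n n≥1))
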